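{- Let $p\ge 2$, $n\ge 2$, let $E(X)=X^n+a_{n-1}X^{n-1}+\dots+a_0\in\mathbb{Z}[X]$ be irreducible, let $\gamma$ be an integer with $E(\gamma)\equiv0\pmod p$. Let $\mathbf{A}$ be the $n\times n$ matrix with rows $A_0=(p,0,\dots,0)$ and $A_i=-\gamma e_{i-1}+e_i$ ($1\le i\le n-1$), and let $\mathfrak{L}\subseteq\mathbb{Z}^n$ be the lattice generated by its rows. Let $\mathbf{C}$ be the companion matrix of $E$ (entries $\mathbf{C}_{i,i+1}=1$ for $0\le i\le n-2$, last row $(-a_0,\dots,-a_{n-1})$, others $0$). Let $\mathfrak{L}_D\subseteq\mathbb{Z}^{n^2}$ be the rank-$n$ lattice generated by the rows of the $n\times n^2$ block matrix $\mathbf{D}=(\mathbf{A}\mid\mathbf{A}\mathbf{C}\mid\mathbf{A}\mathbf{C}^2\mid\cdots\mid\mathbf{A}\mathbf{C}^{n-1})$. Let $\overline{V}\in\mathfrak{L}_D$ be nonzero and write $\overline{V}=(V_0,V_1,\dots,V_{n-1})$ with each $V_i\in\mathbb{Z}^n$. Then (1) $V_0\in\mathfrak{L}$, and (2) $V_0,V_1,\dots,V_{n-1}$ form a basis of a sublattice $\mathfrak{L}'\subseteq\mathfrak{L}$ (of rank $n$).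
   Context: $e_0,\dots,e_{n-1}$ is the standard basis of $\mathbb{Z}^n$; vectors of $\mathbb{Z}^n$ are identified with polynomials of degree $<n$ and $V\mathbf{C}$ is the coefficient vector of $X\cdot V(X)\bmod E(X)$. -}

module Defs where

open import Data.Nat as ℕ using (ℕ; zero; suc; _<?_)
open import Data.Fin using (Fin; toℕ; fromℕ<)
open import Data.Integer using (ℤ; +_; -_; _+_; _*_; _^_; 0ℤ; 1ℤ; -1ℤ)
open import Data.Product using (Σ; ∃; _×_; _,_)
open import Data.Sum using (_⊎_)
open import Relation.Nullary using (¬_; yes; no)
open import Relation.Binary.PropositionalEquality using (_≡_)

Σ[_] : ∀ n → (Fin n → ℤ) → ℤ
Σ[ zero ] f = 0ℤ
Σ[ suc n ] f = f Fin.zero + Σ[ n ] (λ i → f (Fin.suc i))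

-- Vectors of ℤ^n are functions Fin n → ℤ (row vectors);
-- matrices are Fin m → Fin k → ℤ (row index first).
Vec : ℕ → Set
Vec n = Fin n → ℤ

Mat : ℕ → ℕ → Set
Mat m k = Fin m → Fin k → ℤ

_·ᵥ_ : ∀ {m k} → Vec m → Mat m k → Vec k
_·ᵥ_ {m} x M j = Σ[ m ] (λ i → x i * M i j)

_·ₘ_ : ∀ {m k l} → Mat m k → Mat k l → Mat m l
(M ·ₘ N) i = M i ·ᵥ N

Id : ∀ n → Mat n n
Id n i j with toℕ i ℕ.≟ toℕ j
... | yes _ = 1ℤ
... | no _ = 0ℤ

_^ₘ_ : ∀ {n} → Mat n n → ℕ → Mat n n
_^ₘ_ {n} M zero = Id n
M ^ₘ suc k = (M ^ₘ k) ·ₘ M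

InLattice : ∀ {n m} → Mat m n → Vec n → Set
InLattice {n} {m} B v = Σ (Vec m) λ y → ∀ j → v j ≡ (y ·ᵥ B) j

LinIndep : ∀ {m n} → Mat m n → Set
LinIndep {m} {n} V =
  ∀ (c : Vec m) → (∀ j → Σ[ m ] (λ i → c i * V i j) ≡ 0ℤ) → ∀ i → c i ≡ 0ℤ

matA : ∀ n → ℤ → ℤ → Mat n n
matA n p γ i j with toℕ i | toℕ j
... | zero | zero = p
... | zero | suc _ = 0ℤ
... | suc i' | j' with j' ℕ.≟ i'
...   | yes _ = - γ
...   | no _ with j' ℕ.≟ suc i'
...     | yes _ = 1ℤ
...     | no _ = 0ℤ

companion : ∀ n → Vec n → Mat n n
companion n a i j with suc (toℕ i) ℕ.≟ n
... | yes _ = - a j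
... | no _ with toℕ j ℕ.≟ suc (toℕ i)
...   | yes _ = 1ℤ
...   | no _ = 0ℤ

-- Integer polynomials as coefficient sequences ℕ → ℤ (coefficient of X^k)
-- with finite support.
Poly : Set
Poly = ℕ → ℤ

FiniteSupport : Poly → Set
FiniteSupport f = ∃ λ d → ∀ k → d ℕ.≤ k → f k ≡ 0ℤ

sumUpTo : ℕ → (ℕ → ℤ) → ℤ
sumUpTo zero g = g zero
sumUpTo (suc k) g = sumUpTo k g + g (suc k)

_⊛_ : Poly → Poly → Poly
(f ⊛ g) k = sumUpTo k (λ i → f i * g (k ℕ.∸ i))

IsUnit : Poly → Set
IsUnit f = (f 0 ≡ 1ℤ ⊎ f 0 ≡ -1ℤ) × (∀ k → f (suc k) ≡ 0ℤ)

Irreducible : Poly → Set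
Irreducible e =
  ¬ (∀ k → e k ≡ 0ℤ) × ¬ IsUnit e ×
  (∀ f g → FiniteSupport f → FiniteSupport g →
     (∀ k → (f ⊛ g) k ≡ e k) → IsUnit f ⊎ IsUnit g)

monicPoly : ∀ n → Vec n → Poly
monicPoly n a k with k <? n
... | yes k<n = a (fromℕ< k<n)
... | no _ with k ℕ.≟ n
...   | yes _ = 1ℤ
...   | no _ = 0ℤ

evalMonic : ∀ n → Vec n → ℤ → ℤ
evalMonic n a γ = γ ^ n + Σ[ n ] (λ i → a i * γ ^ toℕ i)

matD-block : ∀ n → Vec n → ℤ → ℤ → Fin n → Mat n n
matD-block n a p γ i = matA n p γ ·ₘ (companion n a ^ₘ toℕ i)

-- Identify ℤⁿ with the polynomials of degree < n. The rows of A are p and X^(i-1) (X - γ), so 𝔏 is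
-- the set of v with p ∣ v(γ); right multiplication by C is multiplication by X modulo E, so
-- V_i ≡ X^i V_0 (mod E). As p ∣ E(γ), evaluating at γ puts every V_i in 𝔏. A relation Σ c_i V_i = 0
-- says c V_0 ≡ 0 (mod E) with deg c, deg V_0 < n. Pseudo-dividing E by such a c of least degree
-- leaves a remainder of the same kind, hence zero; then Gauss's lemma turns ℓ^k E = h c into a
-- factorisation of E with a factor of degree strictly between 0 and n, contradicting irreducibility.
module Submission where

open import Defs
open import Data.Nat as ℕ using (ℕ; zero; suc; _∸_; _≤_; _<_; z≤n; s≤s)
import Data.Nat.Properties as ℕP
open import Data.Nat.Induction using (<-rec)
import Data.Nat.Divisibility as ℕD
open import Data.Nat.Primality using (Prime; euclidsLemma; prime⇒nonTrivial; prime⇒nonZero)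
open import Data.Nat.Primality.Factorisation using (PrimeFactorisation; factorise)
open import Data.Nat.ListAction using (product)
open import Data.List.Relation.Unary.All using (All; []; _∷_)
open import Data.Fin as Fin using (Fin; toℕ)
import Data.Fin.Properties as FinP
open import Data.Integer as ℤ using (ℤ; +_; -_; _+_; _*_; 0ℤ; 1ℤ; -1ℤ) renaming (_≤_ to _ℤ≤_)
import Data.Integer.Properties as ℤP
open import Algebra.Properties.Semiring.Sum ℤP.+-*-semiring
  using (sum; sum-cong-≗; sum-replicate-zero; ∑-comm; *-distribˡ-sum; *-distribʳ-sum)
open import Data.Integer.Divisibility.Signed
  using (_∣_; divides; _∣?_; ∣-refl; ∣ᵤ⇒∣; ∣⇒∣ᵤ; ∣m+n∣m⇒∣n; ∣m⇒∣m*n; ∣n⇒∣m*n; ∣m∣n⇒∣m+n)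
open import Data.Integer.Divisibility using () renaming (_∣_ to _∣ᵤ_)
open import Data.Integer.Tactic.RingSolver using (solve-∀)
open import Data.List using (List; []; _∷_; map; length; drop)
open import Data.Product using (Σ; ∃; _×_; _,_; proj₁; proj₂)
open import Data.Sum as Sum using (_⊎_; inj₁; inj₂; [_,_]′)
open import Data.Empty using (⊥; ⊥-elim)
open import Function using (_∘_)
open import Relation.Nullary using (¬_; Dec; yes; no)
open import Relation.Binary.Bundles using (Setoid)
open import Relation.Binary.PropositionalEquality
  using (_≡_; refl; sym; trans; cong; cong₂; subst; module ≡-Reasoning)

-- Polynomials in ℤ[X]

-- Coefficient lists, lowest degree first, compared coefficientwise (so trailing zeros do not matter).
coeff : List ℤ → ℕ → ℤ
coeff []      k       = 0ℤ
coeff (a ∷ f) zero    = a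
coeff (a ∷ f) (suc k) = coeff f k

infix 4 _≈_
record _≈_ (f g : List ℤ) : Set where
  constructor coeffwise
  field ≈-at : ∀ k → coeff f k ≡ coeff g k
open _≈_ public

≈-refl : ∀ {f} → f ≈ f
≈-refl = coeffwise λ _ → refl

≈-sym : ∀ {f g} → f ≈ g → g ≈ f
≈-sym e = coeffwise λ k → sym (≈-at e k)

≈-trans : ∀ {f g h} → f ≈ g → g ≈ h → f ≈ h
≈-trans e e′ = coeffwise λ k → trans (≈-at e k) (≈-at e′ k)

≈-reflexive : ∀ {f g} → f ≡ g → f ≈ g
≈-reflexive refl = ≈-refl

≈-setoid : Setoid _ _
≈-setoid = record
  { Carrier = List ℤ ; _≈_ = _≈_
  ; isEquivalence = record { refl = ≈-refl ; sym = ≈-sym ; trans = ≈-trans } }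

infixl 6 _⊕_
infixl 7 _⊗_
infixr 8 _•_

_⊕_ : List ℤ → List ℤ → List ℤ
[]      ⊕ g       = g
(a ∷ f) ⊕ []      = a ∷ f
(a ∷ f) ⊕ (b ∷ g) = a + b ∷ f ⊕ g

_•_ : ℤ → List ℤ → List ℤ
z • f = map (z *_) f

shift : List ℤ → List ℤ
shift f = 0ℤ ∷ f

_⊗_ : List ℤ → List ℤ → List ℤ
[]      ⊗ g = []
(a ∷ f) ⊗ g = a • g ⊕ shift (f ⊗ g)

shiftBy : ℕ → List ℤ → List ℤ
shiftBy zero    f = f
shiftBy (suc j) f = shift (shiftBy j f)

coeff-⊕ : ∀ f g k → coeff (f ⊕ g) k ≡ coeff f k + coeff g k
coeff-⊕ []      g       k       = sym (ℤP.+-identityˡ _)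
coeff-⊕ (a ∷ f) []      k       = sym (ℤP.+-identityʳ _)
coeff-⊕ (a ∷ f) (b ∷ g) zero    = refl
coeff-⊕ (a ∷ f) (b ∷ g) (suc k) = coeff-⊕ f g k

coeff-• : ∀ z f k → coeff (z • f) k ≡ z * coeff f k
coeff-• z []      k       = sym (ℤP.*-zeroʳ z)
coeff-• z (a ∷ f) zero    = refl
coeff-• z (a ∷ f) (suc k) = coeff-• z f k

coeff-shiftBy : ∀ j f k → coeff (shiftBy j f) (j ℕ.+ k) ≡ coeff f k
coeff-shiftBy zero    f k = refl
coeff-shiftBy (suc j) f k = coeff-shiftBy j f k

⊕-cong : ∀ {f f′ g g′} → f ≈ f′ → g ≈ g′ → f ⊕ g ≈ f′ ⊕ g′
⊕-cong {f} {f′} {g} {g′} e e′ = coeffwise λ k →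
  trans (coeff-⊕ f g k) (trans (cong₂ _+_ (≈-at e k) (≈-at e′ k)) (sym (coeff-⊕ f′ g′ k)))

•-cong : ∀ z {f f′} → f ≈ f′ → z • f ≈ z • f′
•-cong z {f} {f′} e = coeffwise λ k →
  trans (coeff-• z f k) (trans (cong (z *_) (≈-at e k)) (sym (coeff-• z f′ k)))

shift-cong : ∀ {f f′} → f ≈ f′ → shift f ≈ shift f′
shift-cong e = coeffwise λ { zero → refl ; (suc k) → ≈-at e k }

•-congˡ : ∀ {y z} f → y ≡ z → y • f ≈ z • f
•-congˡ f refl = ≈-refl

⊕-identityʳ : ∀ f → f ⊕ [] ≈ f
⊕-identityʳ f = coeffwise λ k → trans (coeff-⊕ f [] k) (ℤP.+-identityʳ _)

⊕-comm : ∀ f g → f ⊕ g ≈ g ⊕ f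
⊕-comm f g = coeffwise λ k →
  trans (coeff-⊕ f g k) (trans (ℤP.+-comm (coeff f k) (coeff g k)) (sym (coeff-⊕ g f k)))

⊕-assoc : ∀ f g h → (f ⊕ g) ⊕ h ≈ f ⊕ (g ⊕ h)
⊕-assoc f g h = coeffwise λ k → begin
  coeff ((f ⊕ g) ⊕ h) k              ≡⟨ trans (coeff-⊕ (f ⊕ g) h k) (cong (_+ coeff h k) (coeff-⊕ f g k)) ⟩
  coeff f k + coeff g k + coeff h k  ≡⟨ ℤP.+-assoc (coeff f k) (coeff g k) (coeff h k) ⟩
  coeff f k + (coeff g k + coeff h k) ≡⟨ sym (trans (coeff-⊕ f (g ⊕ h) k) (cong (_+_ (coeff f k)) (coeff-⊕ g h k))) ⟩
  coeff (f ⊕ (g ⊕ h)) k              ∎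
  where open ≡-Reasoning

⊕-interchange : ∀ f g h i → (f ⊕ g) ⊕ (h ⊕ i) ≈ (f ⊕ h) ⊕ (g ⊕ i)
⊕-interchange f g h i = coeffwise go
  where
  swap : ∀ (a b c d : ℤ) → (a + b) + (c + d) ≡ (a + c) + (b + d)
  swap = solve-∀
  go : ∀ k → coeff ((f ⊕ g) ⊕ (h ⊕ i)) k ≡ coeff ((f ⊕ h) ⊕ (g ⊕ i)) k
  go k rewrite coeff-⊕ (f ⊕ g) (h ⊕ i) k | coeff-⊕ (f ⊕ h) (g ⊕ i) k
             | coeff-⊕ f g k | coeff-⊕ h i k | coeff-⊕ f h k | coeff-⊕ g i k
             = swap (coeff f k) (coeff g k) (coeff h k) (coeff i k)

⊕-cancelˡ : ∀ f g → g ≈ (f ⊕ g) ⊕ -1ℤ • f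
⊕-cancelˡ f g = coeffwise go
  where
  cancel : ∀ (x y : ℤ) → y ≡ (x + y) + -1ℤ * x
  cancel = solve-∀
  go : ∀ k → coeff g k ≡ coeff ((f ⊕ g) ⊕ -1ℤ • f) k
  go k rewrite coeff-⊕ (f ⊕ g) (-1ℤ • f) k | coeff-⊕ f g k | coeff-• -1ℤ f k = cancel (coeff f k) (coeff g k)

•-distrib-⊕ : ∀ z f g → z • (f ⊕ g) ≈ z • f ⊕ z • g
•-distrib-⊕ z f g = coeffwise go
  where
  go : ∀ k → coeff (z • (f ⊕ g)) k ≡ coeff (z • f ⊕ z • g) k
  go k rewrite coeff-⊕ (z • f) (z • g) k | coeff-• z (f ⊕ g) k | coeff-⊕ f g k
             | coeff-• z f k | coeff-• z g k = ℤP.*-distribˡ-+ z (coeff f k) (coeff g k)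

•-assoc : ∀ y z f → y • z • f ≈ (y * z) • f
•-assoc y z f = coeffwise go
  where
  go : ∀ k → coeff (y • z • f) k ≡ coeff ((y * z) • f) k
  go k rewrite coeff-• y (z • f) k | coeff-• z f k | coeff-• (y * z) f k = sym (ℤP.*-assoc y z _)

•-identity : ∀ f → 1ℤ • f ≈ f
•-identity f = coeffwise λ k → trans (coeff-• 1ℤ f k) (ℤP.*-identityˡ _)

•-shift : ∀ z f → z • shift f ≈ shift (z • f)
•-shift z f = coeffwise λ { zero → ℤP.*-zeroʳ z ; (suc k) → refl }

shift-⊕ : ∀ f g → shift f ⊕ shift g ≈ shift (f ⊕ g)
shift-⊕ f g = coeffwise λ { zero → refl ; (suc k) → refl }

shift-[] : shift [] ≈ []
shift-[] = coeffwise λ { zero → refl ; (suc k) → refl }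

sumUpTo-suc : ∀ k (h : ℕ → ℤ) → sumUpTo (suc k) h ≡ h 0 + sumUpTo k (λ i → h (suc i))
sumUpTo-suc zero    h = refl
sumUpTo-suc (suc k) h = trans (cong (_+ h (suc (suc k))) (sumUpTo-suc k h))
  (ℤP.+-assoc (h 0) (sumUpTo k (λ i → h (suc i))) (h (suc (suc k))))

sumUpTo-cong : ∀ k {h h′ : ℕ → ℤ} → (∀ i → h i ≡ h′ i) → sumUpTo k h ≡ sumUpTo k h′
sumUpTo-cong zero    e = e 0
sumUpTo-cong (suc k) e = cong₂ _+_ (sumUpTo-cong k e) (e (suc k))

sumUpTo-zero : ∀ k → sumUpTo k (λ _ → 0ℤ) ≡ 0ℤ
sumUpTo-zero zero    = refl
sumUpTo-zero (suc k) = cong (_+ 0ℤ) (sumUpTo-zero k)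

coeff-⊗ : ∀ f g k → coeff (f ⊗ g) k ≡ (coeff f ⊛ coeff g) k
coeff-⊗ []      g k       = sym (sumUpTo-zero k)
coeff-⊗ (a ∷ f) g zero    =
  trans (coeff-⊕ (a • g) (shift (f ⊗ g)) zero) (trans (ℤP.+-identityʳ _) (coeff-• a g zero))
coeff-⊗ (a ∷ f) g (suc k) = trans (coeff-⊕ (a • g) (shift (f ⊗ g)) (suc k))
  (trans (cong₂ _+_ (coeff-• a g (suc k)) (coeff-⊗ f g k))
    (sym (sumUpTo-suc k (λ i → coeff (a ∷ f) i * coeff g (suc k ∸ i)))))

⊗-cong : ∀ {f f′ g g′} → f ≈ f′ → g ≈ g′ → f ⊗ g ≈ f′ ⊗ g′
⊗-cong {f} {f′} {g} {g′} e e′ = coeffwise λ k → trans (coeff-⊗ f g k)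
  (trans (sumUpTo-cong k (λ i → cong₂ _*_ (≈-at e i) (≈-at e′ (k ∸ i)))) (sym (coeff-⊗ f′ g′ k)))

⊗-zeroʳ : ∀ f → f ⊗ [] ≈ []
⊗-zeroʳ []      = ≈-refl
⊗-zeroʳ (a ∷ f) = ≈-trans (shift-cong (⊗-zeroʳ f)) shift-[]

⊗-∷ʳ : ∀ f b g → f ⊗ (b ∷ g) ≈ b • f ⊕ shift (f ⊗ g)
⊗-∷ʳ []      b g = ≈-sym shift-[]
⊗-∷ʳ (a ∷ f) b g = coeffwise go
  where
  open ≡-Reasoning
  swap : ∀ (x y z : ℤ) → x + (y + z) ≡ y + (x + z)
  swap = solve-∀
  go : ∀ k → coeff ((a ∷ f) ⊗ (b ∷ g)) k ≡ coeff (b • (a ∷ f) ⊕ shift ((a ∷ f) ⊗ g)) k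
  go zero    = cong (_+ 0ℤ) (ℤP.*-comm a b)
  go (suc k) = begin
    coeff (a • g ⊕ f ⊗ (b ∷ g)) k
      ≡⟨ coeff-⊕ (a • g) _ k ⟩
    coeff (a • g) k + coeff (f ⊗ (b ∷ g)) k
      ≡⟨ cong (_+_ (coeff (a • g) k)) (trans (≈-at (⊗-∷ʳ f b g) k) (coeff-⊕ (b • f) _ k)) ⟩
    coeff (a • g) k + (coeff (b • f) k + coeff (shift (f ⊗ g)) k)
      ≡⟨ swap (coeff (a • g) k) (coeff (b • f) k) (coeff (shift (f ⊗ g)) k) ⟩
    coeff (b • f) k + (coeff (a • g) k + coeff (shift (f ⊗ g)) k)
      ≡⟨ cong (_+_ (coeff (b • f) k)) (sym (coeff-⊕ (a • g) _ k)) ⟩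
    coeff (b • f) k + coeff (a • g ⊕ shift (f ⊗ g)) k
      ≡⟨ sym (coeff-⊕ (b • f) _ k) ⟩
    coeff (b • f ⊕ (a • g ⊕ shift (f ⊗ g))) k ∎

⊗-comm : ∀ f g → f ⊗ g ≈ g ⊗ f
⊗-comm []      g = ≈-sym (⊗-zeroʳ g)
⊗-comm (a ∷ f) g = ≈-trans (⊕-cong (≈-refl {a • g}) (shift-cong (⊗-comm f g))) (≈-sym (⊗-∷ʳ g a f))

⊗-distribˡ : ∀ f g h → f ⊗ (g ⊕ h) ≈ f ⊗ g ⊕ f ⊗ h
⊗-distribˡ []      g h = ≈-refl
⊗-distribˡ (a ∷ f) g h = begin
  a • (g ⊕ h) ⊕ shift (f ⊗ (g ⊕ h))             ≈⟨ ⊕-cong (•-distrib-⊕ a g h) (shift-cong (⊗-distribˡ f g h)) ⟩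
  (a • g ⊕ a • h) ⊕ shift (f ⊗ g ⊕ f ⊗ h)       ≈⟨ ⊕-cong (≈-refl {a • g ⊕ a • h}) (≈-sym (shift-⊕ (f ⊗ g) (f ⊗ h))) ⟩
  (a • g ⊕ a • h) ⊕ (shift (f ⊗ g) ⊕ shift (f ⊗ h)) ≈⟨ ⊕-interchange (a • g) (a • h) (shift (f ⊗ g)) (shift (f ⊗ h)) ⟩
  (a • g ⊕ shift (f ⊗ g)) ⊕ (a • h ⊕ shift (f ⊗ h)) ∎
  where open import Relation.Binary.Reasoning.Setoid ≈-setoid

⊗-distribʳ : ∀ f g h → (f ⊕ g) ⊗ h ≈ f ⊗ h ⊕ g ⊗ h
⊗-distribʳ f g h = ≈-trans (⊗-comm (f ⊕ g) h)
  (≈-trans (⊗-distribˡ h f g) (⊕-cong (⊗-comm h f) (⊗-comm h g)))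

•-⊗ : ∀ z f g → (z • f) ⊗ g ≈ z • (f ⊗ g)
•-⊗ z []      g = ≈-refl
•-⊗ z (b ∷ f) g = begin
  (z * b) • g ⊕ shift ((z • f) ⊗ g)  ≈⟨ ⊕-cong (≈-sym (•-assoc z b g)) (shift-cong (•-⊗ z f g)) ⟩
  z • b • g ⊕ shift (z • (f ⊗ g))    ≈⟨ ⊕-cong (≈-refl {z • b • g}) (≈-sym (•-shift z (f ⊗ g))) ⟩
  z • b • g ⊕ z • shift (f ⊗ g)      ≈⟨ ≈-sym (•-distrib-⊕ z (b • g) (shift (f ⊗ g))) ⟩
  z • (b • g ⊕ shift (f ⊗ g))        ∎
  where open import Relation.Binary.Reasoning.Setoid ≈-setoid

⊗-• : ∀ z f g → f ⊗ (z • g) ≈ z • (f ⊗ g)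
⊗-• z f g = ≈-trans (⊗-comm f (z • g)) (≈-trans (•-⊗ z g f) (•-cong z (⊗-comm g f)))

shift-⊗ : ∀ f g → shift f ⊗ g ≈ shift (f ⊗ g)
shift-⊗ f g = coeffwise λ k → trans (coeff-⊕ (0ℤ • g) (shift (f ⊗ g)) k)
  (trans (cong (_+ coeff (shift (f ⊗ g)) k) (trans (coeff-• 0ℤ g k) (ℤP.*-zeroˡ (coeff g k)))) (ℤP.+-identityˡ _))

⊗-shift : ∀ f g → f ⊗ shift g ≈ shift (f ⊗ g)
⊗-shift f g = ≈-trans (⊗-comm f (shift g)) (≈-trans (shift-⊗ g f) (shift-cong (⊗-comm g f)))

⊗-assoc : ∀ f g h → (f ⊗ g) ⊗ h ≈ f ⊗ (g ⊗ h)
⊗-assoc []      g h = ≈-refl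
⊗-assoc (a ∷ f) g h = begin
  (a • g ⊕ shift (f ⊗ g)) ⊗ h          ≈⟨ ⊗-distribʳ (a • g) _ h ⟩
  (a • g) ⊗ h ⊕ shift (f ⊗ g) ⊗ h      ≈⟨ ⊕-cong (•-⊗ a g h) (shift-⊗ (f ⊗ g) h) ⟩
  a • (g ⊗ h) ⊕ shift ((f ⊗ g) ⊗ h)    ≈⟨ ⊕-cong (≈-refl {a • (g ⊗ h)}) (shift-cong (⊗-assoc f g h)) ⟩
  a • (g ⊗ h) ⊕ shift (f ⊗ (g ⊗ h))    ∎
  where open import Relation.Binary.Reasoning.Setoid ≈-setoid

constant-⊗ : ∀ a g → (a ∷ []) ⊗ g ≈ a • g
constant-⊗ a g = ≈-trans (⊕-cong (≈-refl {a • g}) shift-[]) (⊕-identityʳ (a • g))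

⊗-identityˡ : ∀ f → (1ℤ ∷ []) ⊗ f ≈ f
⊗-identityˡ f = ≈-trans (constant-⊗ 1ℤ f) (•-identity f)

⊗-identityʳ : ∀ f → f ⊗ (1ℤ ∷ []) ≈ f
⊗-identityʳ f = ≈-trans (⊗-comm f (1ℤ ∷ [])) (⊗-identityˡ f)

shiftBy-⊗ : ∀ j f g → shiftBy j f ⊗ g ≈ shiftBy j (f ⊗ g)
shiftBy-⊗ zero    f g = ≈-refl
shiftBy-⊗ (suc j) f g = ≈-trans (shift-⊗ (shiftBy j f) g) (shift-cong (shiftBy-⊗ j f g))

DegBelow : ℕ → List ℤ → Set
DegBelow m f = ∀ k → m ≤ k → coeff f k ≡ 0ℤ

HasDegree : ℕ → List ℤ → Set
HasDegree d f = ¬ coeff f d ≡ 0ℤ × DegBelow (suc d) f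

DegBelow-mono : ∀ {m m′} f → m ≤ m′ → DegBelow m f → DegBelow m′ f
DegBelow-mono f m≤m′ f<m k m′≤k = f<m k (ℕP.≤-trans m≤m′ m′≤k)

DegBelow-⊕ : ∀ {m} f g → DegBelow m f → DegBelow m g → DegBelow m (f ⊕ g)
DegBelow-⊕ f g f<m g<m k m≤k = trans (coeff-⊕ f g k) (cong₂ _+_ (f<m k m≤k) (g<m k m≤k))

DegBelow-• : ∀ {m} z f → DegBelow m f → DegBelow m (z • f)
DegBelow-• z f f<m k m≤k = trans (coeff-• z f k) (trans (cong (z *_) (f<m k m≤k)) (ℤP.*-zeroʳ z))

DegBelow-shift : ∀ {m} f → DegBelow m f → DegBelow (suc m) (shift f)
DegBelow-shift f f<m (suc k) (s≤s m≤k) = f<m k m≤k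

DegBelow-shiftBy : ∀ j {m} f → DegBelow m f → DegBelow (j ℕ.+ m) (shiftBy j f)
DegBelow-shiftBy zero    f f<m = f<m
DegBelow-shiftBy (suc j) f f<m = DegBelow-shift (shiftBy j f) (DegBelow-shiftBy j f f<m)

DegBelow-1⇒constant : ∀ f → DegBelow 1 f → f ≈ (coeff f 0 ∷ [])
DegBelow-1⇒constant f f<1 = coeffwise λ { zero → refl ; (suc k) → f<1 (suc k) (s≤s z≤n) }

zero⊎degree : ∀ m f → DegBelow m f → f ≈ [] ⊎ ∃ λ d → d < m × HasDegree d f
zero⊎degree zero    f f<0 = inj₁ (coeffwise λ k → f<0 k z≤n)
zero⊎degree (suc m) f f≤m with coeff f m ℤ.≟ 0ℤ
... | no fm≢0 = inj₂ (m , ℕP.≤-refl , fm≢0 , f≤m)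
... | yes fm≡0 with zero⊎degree m f f<m
  where
  f<m : DegBelow m f
  f<m k m≤k with ℕP.m≤n⇒m<n∨m≡n m≤k
  ... | inj₁ m<k  = f≤m k m<k
  ... | inj₂ refl = fm≡0
... | inj₁ f≈0 = inj₁ f≈0
... | inj₂ (d , d<m , f-deg) = inj₂ (d , ℕP.m<n⇒m<1+n d<m , f-deg)

-- Congruence modulo a polynomial

module Modulo (E : List ℤ) where

  infix 4 _≋_
  record _≋_ (f g : List ℤ) : Set where
    constructor _by_
    field
      quotient : List ℤ
      ≋-spec   : f ≈ g ⊕ quotient ⊗ E
  open _≋_ public

  ≈⇒≋ : ∀ {f g} → f ≈ g → f ≋ g
  ≈⇒≋ {f} {g} f≈g = [] by ≈-trans f≈g (≈-sym (⊕-identityʳ g))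

  ≋-refl : ∀ {f} → f ≋ f
  ≋-refl = ≈⇒≋ ≈-refl

  ≋-sym : ∀ {f g} → f ≋ g → g ≋ f
  ≋-sym {f} {g} (q by f≈) = (-1ℤ • q) by coeffwise go
    where
    cancel : ∀ (x y : ℤ) → x ≡ (x + y) + -1ℤ * y
    cancel = solve-∀
    go : ∀ k → coeff g k ≡ coeff (f ⊕ (-1ℤ • q) ⊗ E) k
    go k rewrite coeff-⊕ f ((-1ℤ • q) ⊗ E) k | ≈-at (•-⊗ -1ℤ q E) k | coeff-• -1ℤ (q ⊗ E) k
               | ≈-at f≈ k | coeff-⊕ g (q ⊗ E) k = cancel (coeff g k) (coeff (q ⊗ E) k)

  ≋-trans : ∀ {f g h} → f ≋ g → g ≋ h → f ≋ h
  ≋-trans {f} {g} {h} (q by f≈) (q′ by g≈) = (q′ ⊕ q) by (begin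
    f                            ≈⟨ f≈ ⟩
    g ⊕ q ⊗ E                    ≈⟨ ⊕-cong g≈ (≈-refl {q ⊗ E}) ⟩
    (h ⊕ q′ ⊗ E) ⊕ q ⊗ E          ≈⟨ ⊕-assoc h (q′ ⊗ E) (q ⊗ E) ⟩
    h ⊕ (q′ ⊗ E ⊕ q ⊗ E)          ≈⟨ ⊕-cong (≈-refl {h}) (≈-sym (⊗-distribʳ q′ q E)) ⟩
    h ⊕ (q′ ⊕ q) ⊗ E              ∎)
    where open import Relation.Binary.Reasoning.Setoid ≈-setoid

  ≋-setoid : Setoid _ _
  ≋-setoid = record
    { Carrier = List ℤ ; _≈_ = _≋_
    ; isEquivalence = record { refl = ≋-refl ; sym = ≋-sym ; trans = ≋-trans } }

  multiple≋[] : ∀ q → q ⊗ E ≋ []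
  multiple≋[] q = q by ≈-refl

  ⊕-cong-≋ : ∀ {f f′ g g′} → f ≋ f′ → g ≋ g′ → f ⊕ g ≋ f′ ⊕ g′
  ⊕-cong-≋ {f} {f′} {g} {g′} (q by f≈) (q′ by g≈) = (q ⊕ q′) by (begin
    f ⊕ g                              ≈⟨ ⊕-cong f≈ g≈ ⟩
    (f′ ⊕ q ⊗ E) ⊕ (g′ ⊕ q′ ⊗ E)        ≈⟨ ⊕-interchange f′ (q ⊗ E) g′ (q′ ⊗ E) ⟩
    (f′ ⊕ g′) ⊕ (q ⊗ E ⊕ q′ ⊗ E)        ≈⟨ ⊕-cong (≈-refl {f′ ⊕ g′}) (≈-sym (⊗-distribʳ q q′ E)) ⟩
    (f′ ⊕ g′) ⊕ (q ⊕ q′) ⊗ E            ∎)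
    where open import Relation.Binary.Reasoning.Setoid ≈-setoid

  •-cong-≋ : ∀ z {f g} → f ≋ g → z • f ≋ z • g
  •-cong-≋ z {f} {g} (q by f≈) = (z • q) by (begin
    z • f                  ≈⟨ •-cong z f≈ ⟩
    z • (g ⊕ q ⊗ E)        ≈⟨ •-distrib-⊕ z g (q ⊗ E) ⟩
    z • g ⊕ z • (q ⊗ E)    ≈⟨ ⊕-cong (≈-refl {z • g}) (≈-sym (•-⊗ z q E)) ⟩
    z • g ⊕ (z • q) ⊗ E    ∎)
    where open import Relation.Binary.Reasoning.Setoid ≈-setoid

  ⊗-congʳ-≋ : ∀ h {f g} → f ≋ g → h ⊗ f ≋ h ⊗ g
  ⊗-congʳ-≋ h {f} {g} (q by f≈) = (h ⊗ q) by (begin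
    h ⊗ f                  ≈⟨ ⊗-cong (≈-refl {h}) f≈ ⟩
    h ⊗ (g ⊕ q ⊗ E)        ≈⟨ ⊗-distribˡ h g (q ⊗ E) ⟩
    h ⊗ g ⊕ h ⊗ (q ⊗ E)    ≈⟨ ⊕-cong (≈-refl {h ⊗ g}) (≈-sym (⊗-assoc h q E)) ⟩
    h ⊗ g ⊕ (h ⊗ q) ⊗ E    ∎)
    where open import Relation.Binary.Reasoning.Setoid ≈-setoid

  shift-cong-≋ : ∀ {f g} → f ≋ g → shift f ≋ shift g
  shift-cong-≋ {f} {g} (q by f≈) = shift q by (begin
    shift f                    ≈⟨ shift-cong f≈ ⟩
    shift (g ⊕ q ⊗ E)          ≈⟨ ≈-sym (shift-⊕ g (q ⊗ E)) ⟩
    shift g ⊕ shift (q ⊗ E)    ≈⟨ ⊕-cong (≈-refl {shift g}) (≈-sym (shift-⊗ q E)) ⟩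
    shift g ⊕ shift q ⊗ E      ∎)
    where open import Relation.Binary.Reasoning.Setoid ≈-setoid

-- Pseudo-division

monomial : ℕ → List ℤ
monomial j = shiftBy j (1ℤ ∷ [])

monomial-⊗ : ∀ j u → monomial j ⊗ u ≈ shiftBy j u
monomial-⊗ j u = ≈-trans (shiftBy-⊗ j (1ℤ ∷ []) u)
  (shiftBy-cong j (⊗-identityˡ u))
  where
  shiftBy-cong : ∀ j {f g} → f ≈ g → shiftBy j f ≈ shiftBy j g
  shiftBy-cong zero    e = e
  shiftBy-cong (suc j) e = shift-cong (shiftBy-cong j e)

*-≢0 : ∀ {x y : ℤ} → ¬ x ≡ 0ℤ → ¬ y ≡ 0ℤ → ¬ x * y ≡ 0ℤ
*-≢0 {x} {y} x≢0 y≢0 xy≡0 = [ x≢0 , y≢0 ]′ (ℤP.i*j≡0⇒i≡0∨j≡0 x xy≡0)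

module PseudoDivision {d : ℕ} {u : List ℤ} (u-deg : HasDegree d u) where

  ℓ : ℤ
  ℓ = coeff u d

  record Result (g : List ℤ) : Set where
    constructor result
    field
      scale     : ℤ
      quotient  : List ℤ
      remainder : List ℤ
      scale≢0   : ¬ scale ≡ 0ℤ
      division  : scale • g ≈ quotient ⊗ u ⊕ remainder
      remainder-deg : DegBelow d remainder

  shiftBy-u-deg : ∀ m → d ≤ m → DegBelow (suc m) (shiftBy (m ∸ d) u)
  shiftBy-u-deg m d≤m = subst (λ i → DegBelow i (shiftBy (m ∸ d) u))
    (trans (ℕP.+-suc (m ∸ d) d) (cong suc (ℕP.m∸n+n≡m d≤m)))
    (DegBelow-shiftBy (m ∸ d) u (proj₂ u-deg))

  shiftBy-u-top : ∀ m → d ≤ m → coeff (shiftBy (m ∸ d) u) m ≡ ℓ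
  shiftBy-u-top m d≤m = trans (cong (coeff (shiftBy (m ∸ d) u)) (sym (ℕP.m∸n+n≡m d≤m)))
    (coeff-shiftBy (m ∸ d) u d)

  cancel-top : ∀ m g → d ≤ m → DegBelow (suc m) g →
               DegBelow m (ℓ • g ⊕ (- coeff g m) • shiftBy (m ∸ d) u)
  cancel-top m g d≤m g≤m k m≤k = trans (coeff-⊕ (ℓ • g) ((- c) • s) k)
    (trans (cong₂ _+_ (coeff-• ℓ g k) (coeff-• (- c) s k)) at-k)
    where
    c = coeff g m
    s = shiftBy (m ∸ d) u
    cancel : ∀ (a b : ℤ) → a * b + (- b) * a ≡ 0ℤ
    cancel = solve-∀
    at-k : ℓ * coeff g k + (- c) * coeff s k ≡ 0ℤ
    at-k with ℕP.m≤n⇒m<n∨m≡n m≤k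
    ... | inj₁ m<k = trans (cong₂ _+_ (cong (ℓ *_) (g≤m k m<k)) (cong ((- c) *_) (shiftBy-u-deg m d≤m k m<k)))
                       (cong₂ _+_ (ℤP.*-zeroʳ ℓ) (ℤP.*-zeroʳ (- c)))
    ... | inj₂ refl = trans (cong (_+_ (ℓ * c)) (cong ((- c) *_) (shiftBy-u-top m d≤m))) (cancel ℓ c)

  recombine : ∀ L c g s t → L • (ℓ • g ⊕ (- c) • s) ≈ t → (L * ℓ) • g ≈ t ⊕ (L * c) • s
  recombine L c g s t eq = coeffwise go
    where
    expand : ∀ (L a x c y : ℤ) → (L * a) * x ≡ L * (a * x + (- c) * y) + (L * c) * y
    expand = solve-∀
    go : ∀ k → coeff ((L * ℓ) • g) k ≡ coeff (t ⊕ (L * c) • s) k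
    go k rewrite coeff-• (L * ℓ) g k | coeff-⊕ t ((L * c) • s) k | coeff-• (L * c) s k
               | sym (≈-at eq k) | coeff-• L (ℓ • g ⊕ (- c) • s) k
               | coeff-⊕ (ℓ • g) ((- c) • s) k | coeff-• ℓ g k | coeff-• (- c) s k
               = expand L ℓ (coeff g k) c (coeff s k)

  divide : ∀ m g → DegBelow m g → Result g
  divide zero    g g<0 = result 1ℤ [] g (λ ()) (•-identity g) (DegBelow-mono g z≤n g<0)
  divide (suc m) g g≤m with suc m ℕ.≤? d
  ... | yes m<d = result 1ℤ [] g (λ ()) (•-identity g) (DegBelow-mono g m<d g≤m)
  ... | no m≮d = result (L * ℓ) (h ⊕ (L * c) • monomial j) r (*-≢0 L≢0 (proj₁ u-deg)) division′ r-deg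
    where
    d≤m : d ≤ m
    d≤m = ℕP.≤-pred (ℕP.≰⇒> m≮d)
    j = m ∸ d
    c = coeff g m
    open Result (divide m (ℓ • g ⊕ (- c) • shiftBy j u) (cancel-top m g d≤m g≤m))
      renaming (scale to L; quotient to h; remainder to r; scale≢0 to L≢0; remainder-deg to r-deg)
    division′ : (L * ℓ) • g ≈ (h ⊕ (L * c) • monomial j) ⊗ u ⊕ r
    division′ = begin
      (L * ℓ) • g                                 ≈⟨ recombine L c g (shiftBy j u) _ division ⟩
      (h ⊗ u ⊕ r) ⊕ (L * c) • shiftBy j u         ≈⟨ ⊕-cong (⊕-comm (h ⊗ u) r) (•-cong (L * c) (≈-sym (monomial-⊗ j u))) ⟩
      (r ⊕ h ⊗ u) ⊕ (L * c) • (monomial j ⊗ u)    ≈⟨ ⊕-assoc r (h ⊗ u) _ ⟩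
      r ⊕ (h ⊗ u ⊕ (L * c) • (monomial j ⊗ u))    ≈⟨ ⊕-cong (≈-refl {r}) (⊕-cong (≈-refl {h ⊗ u}) (≈-sym (•-⊗ (L * c) (monomial j) u))) ⟩
      r ⊕ (h ⊗ u ⊕ ((L * c) • monomial j) ⊗ u)    ≈⟨ ⊕-cong (≈-refl {r}) (≈-sym (⊗-distribʳ h _ u)) ⟩
      r ⊕ (h ⊕ (L * c) • monomial j) ⊗ u          ≈⟨ ⊕-comm r _ ⟩
      (h ⊕ (L * c) • monomial j) ⊗ u ⊕ r          ∎
      where open import Relation.Binary.Reasoning.Setoid ≈-setoid

-- Gauss's lemma and removal of scalar factors

•-cancel : ∀ z {f g} → ¬ z ≡ 0ℤ → z • f ≈ z • g → f ≈ g
•-cancel z {f} {g} z≢0 e = coeffwise λ k → ℤP.*-cancelˡ-≡ z (coeff f k) (coeff g k) {{ℤ.≢-nonZero z≢0}}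
  (trans (sym (coeff-• z f k)) (trans (≈-at e k) (coeff-• z g k)))

HasDegree-•⁻¹ : ∀ {z d f g} → ¬ z ≡ 0ℤ → f ≈ z • g → HasDegree d f → HasDegree d g
HasDegree-•⁻¹ {z} {d} {f} {g} z≢0 f≈zg (fd≢0 , f≤d) = gd≢0 , g≤d
  where
  f≡zg : ∀ k → coeff f k ≡ z * coeff g k
  f≡zg k = trans (≈-at f≈zg k) (coeff-• z g k)
  gd≢0 : ¬ coeff g d ≡ 0ℤ
  gd≢0 gd≡0 = fd≢0 (trans (f≡zg d) (trans (cong (z *_) gd≡0) (ℤP.*-zeroʳ z)))
  g≤d : DegBelow (suc d) g
  g≤d k d<k = [ (λ z≡0 → ⊥-elim (z≢0 z≡0)) , (λ gk≡0 → gk≡0) ]′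
    (ℤP.i*j≡0⇒i≡0∨j≡0 z (trans (sym (f≡zg k)) (f≤d k d<k)))

module Gauss {r : ℕ} (r-prime : Prime r) where

  R : ℤ
  R = + r

  R≢0 : ¬ R ≡ 0ℤ
  R≢0 R≡0 = ℕP.<⇒≢ (ℕP.<-trans (s≤s z≤n) (ℕ.nonTrivial⇒n>1 r {{prime⇒nonTrivial r-prime}}))
    (sym (cong ℤ.∣_∣ R≡0))

  R∣_ : List ℤ → Set
  R∣ f = ∀ k → R ∣ coeff f k

  euclid : ∀ a b → R ∣ a * b → R ∣ a ⊎ R ∣ b
  euclid a b R∣ab with euclidsLemma ℤ.∣ a ∣ ℤ.∣ b ∣ r-prime
                         (subst (r ℕD.∣_) (ℤP.abs-* a b) (∣⇒∣ᵤ R∣ab))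
  ... | inj₁ r∣a = inj₁ (∣ᵤ⇒∣ r∣a)
  ... | inj₂ r∣b = inj₂ (∣ᵤ⇒∣ r∣b)

  R∣-∷ˡ : ∀ a f g → R∣ ((a ∷ f) ⊗ g) → R ∣ a → R∣ (f ⊗ g)
  R∣-∷ˡ a f g R∣afg R∣a k = ∣m+n∣m⇒∣n
    (subst (R ∣_) (coeff-⊕ (a • g) (shift (f ⊗ g)) (suc k)) (R∣afg (suc k)))
    (subst (R ∣_) (sym (coeff-• a g (suc k))) (∣m⇒∣m*n (coeff g (suc k)) R∣a))

  R∣-∷ʳ : ∀ f b g → R∣ (f ⊗ (b ∷ g)) → R ∣ b → R∣ (f ⊗ g)
  R∣-∷ʳ f b g R∣fbg R∣b k = ∣m+n∣m⇒∣n
    (subst (R ∣_) (trans (≈-at (⊗-∷ʳ f b g) (suc k)) (coeff-⊕ (b • f) (shift (f ⊗ g)) (suc k))) (R∣fbg (suc k)))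
    (subst (R ∣_) (sym (coeff-• b f (suc k))) (∣m⇒∣m*n (coeff f (suc k)) R∣b))

  -- Strip the lowest coefficients of f and g that are divisible by R; unless one of them is used up,
  -- the constant coefficient a * b of the remaining product is divisible by R, contradicting Euclid.
  gauss : ∀ f g → R∣ (f ⊗ g) → R∣ f ⊎ R∣ g
  gauss []      g _ = inj₁ λ _ → divides 0ℤ refl
  gauss (a ∷ f) g R∣fg with R ∣? a
  ... | yes R∣a = [ (λ R∣f → inj₁ λ { zero → R∣a ; (suc k) → R∣f k }) , inj₂ ]′
                    (gauss f g (R∣-∷ˡ a f g R∣fg R∣a))
  ... | no  R∤a = gaussʳ g R∣fg
    where
    gaussʳ : ∀ g → R∣ ((a ∷ f) ⊗ g) → R∣ (a ∷ f) ⊎ R∣ g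
    gaussʳ []      _ = inj₂ λ _ → divides 0ℤ refl
    gaussʳ (b ∷ g) R∣fg with R ∣? b
    ... | yes R∣b = [ inj₁ , (λ R∣g → inj₂ λ { zero → R∣b ; (suc k) → R∣g k }) ]′
                      (gaussʳ g (R∣-∷ʳ (a ∷ f) b g R∣fg R∣b))
    ... | no  R∤b = ⊥-elim ([ R∤a , R∤b ]′ (euclid a b (subst (R ∣_) (ℤP.+-identityʳ (a * b)) (R∣fg 0))))

  R∣⇒• : ∀ f → R∣ f → ∃ λ f′ → f ≈ R • f′
  R∣⇒• []      _   = [] , ≈-refl
  R∣⇒• (a ∷ f) R∣af with R∣af 0 | R∣⇒• f (λ k → R∣af (suc k))
  ... | divides q a≡qR | f′ , f≈Rf′ =
    q ∷ f′ , coeffwise λ { zero → trans a≡qR (ℤP.*-comm q R) ; (suc k) → ≈-at f≈Rf′ k }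

FactorOfDegree : ℕ → List ℤ → Set
FactorOfDegree d E = Σ (List ℤ) λ h → Σ (List ℤ) λ u → E ≈ h ⊗ u × HasDegree d u

remove-prime : ∀ {r d E} → Prime r → ∀ q → FactorOfDegree d ((q * + r) • E) → FactorOfDegree d (q • E)
remove-prime {r} {d} {E} r-prime q (h , u , qRE≈hu , u-deg) = split (gauss h u R∣hu)
  where
  open Gauss r-prime
  RqE≈hu : R • q • E ≈ h ⊗ u
  RqE≈hu = ≈-trans (•-assoc R q E) (≈-trans (•-congˡ E (ℤP.*-comm R q)) qRE≈hu)
  R∣hu : R∣ (h ⊗ u)
  R∣hu k = subst (R ∣_) (trans (sym (coeff-• R (q • E) k)) (≈-at RqE≈hu k))
    (∣m⇒∣m*n (coeff (q • E) k) ∣-refl)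
  split : R∣ h ⊎ R∣ u → FactorOfDegree d (q • E)
  split (inj₁ R∣h) = let h′ , h≈Rh′ = R∣⇒• h R∣h in
    h′ , u , •-cancel R R≢0 (≈-trans RqE≈hu (≈-trans (⊗-cong h≈Rh′ (≈-refl {u})) (•-⊗ R h′ u))) , u-deg
  split (inj₂ R∣u) = let u′ , u≈Ru′ = R∣⇒• u R∣u in
    h , u′ , •-cancel R R≢0 (≈-trans RqE≈hu (≈-trans (⊗-cong (≈-refl {h}) u≈Ru′) (⊗-• R h u′))) ,
    HasDegree-•⁻¹ R≢0 u≈Ru′ u-deg

∣i∣≡1⇒i*i≡1 : ∀ i → ℤ.∣ i ∣ ≡ 1 → i * i ≡ 1ℤ
∣i∣≡1⇒i*i≡1 (+ 1)          refl = refl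
∣i∣≡1⇒i*i≡1 ℤ.-[1+ zero ]  refl = refl

clear-primes : ∀ {d E} rs → All Prime rs → ∀ z → ℤ.∣ z ∣ ≡ product rs →
               FactorOfDegree d (z • E) → FactorOfDegree d E
clear-primes {d} {E} [] [] z ∣z∣≡1 (h , u , zE≈hu , u-deg) = z • h , u , E≈zhu , u-deg
  where
  E≈zhu : E ≈ (z • h) ⊗ u
  E≈zhu = begin
    E               ≈⟨ ≈-sym (•-identity E) ⟩
    1ℤ • E          ≈⟨ •-congˡ E (sym (∣i∣≡1⇒i*i≡1 z ∣z∣≡1)) ⟩
    (z * z) • E     ≈⟨ ≈-sym (•-assoc z z E) ⟩
    z • z • E       ≈⟨ •-cong z zE≈hu ⟩
    z • (h ⊗ u)     ≈⟨ ≈-sym (•-⊗ z h u) ⟩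
    (z • h) ⊗ u     ∎
    where open import Relation.Binary.Reasoning.Setoid ≈-setoid
clear-primes {d} {E} (r ∷ rs) (r-prime ∷ rs-prime) z ∣z∣≡rrs fac
  with ∣ᵤ⇒∣ {+ r} {z} (ℕD.divides (product rs) (trans ∣z∣≡rrs (ℕP.*-comm r (product rs))))
... | divides q z≡qr = clear-primes rs rs-prime q ∣q∣≡rs
        (remove-prime r-prime q (subst (λ x → FactorOfDegree d (x • E)) z≡qr fac))
  where
  instance _ = prime⇒nonZero r-prime
  ∣q∣≡rs : ℤ.∣ q ∣ ≡ product rs
  ∣q∣≡rs = ℕP.*-cancelʳ-≡ ℤ.∣ q ∣ (product rs) r (begin
    ℤ.∣ q ∣ ℕ.* r    ≡⟨ sym (trans (cong ℤ.∣_∣ z≡qr) (ℤP.abs-* q (+ r))) ⟩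
    ℤ.∣ z ∣          ≡⟨ trans ∣z∣≡rrs (ℕP.*-comm r (product rs)) ⟩
    product rs ℕ.* r ∎)
    where open ≡-Reasoning

clear-scalar : ∀ {d E} z → ¬ z ≡ 0ℤ → FactorOfDegree d (z • E) → FactorOfDegree d E
clear-scalar z z≢0 = clear-primes (factors F) (factorsPrime F) z (isFactorisation F)
  where
  F = factorise ℤ.∣ z ∣ {{ℕ.≢-nonZero (λ ∣z∣≡0 → z≢0 (ℤP.∣i∣≡0⇒i≡0 ∣z∣≡0))}}
  open PrimeFactorisation

-- Zero divisors modulo a monic irreducible polynomial

coeff-∷-⊗ : ∀ a q g k → coeff ((a ∷ q) ⊗ g) k ≡ a * coeff g k + coeff (shift (q ⊗ g)) k
coeff-∷-⊗ a q g k = trans (coeff-⊕ (a • g) (shift (q ⊗ g)) k) (cong (_+ coeff (shift (q ⊗ g)) k) (coeff-• a g k))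

module NoZeroDivisors {n : ℕ} {E : List ℤ}
  (E-monic : coeff E n ≡ 1ℤ) (E-deg : DegBelow (suc n) E)
  (E-irreducible : ∀ h u → E ≈ h ⊗ u → DegBelow 1 h ⊎ DegBelow 1 u) where

  open Modulo E

  multiple-below-n : ∀ q → DegBelow n (q ⊗ E) → q ≈ []
  multiple-below-n []      _     = ≈-refl
  multiple-below-n (a ∷ q) aqE<n = coeffwise λ { zero → a≡0 ; (suc k) → ≈-at q≈[] k }
    where
    open ≡-Reasoning
    qE<n : DegBelow n (q ⊗ E)
    qE<n k n≤k = begin
      coeff (q ⊗ E) k                         ≡⟨ sym (ℤP.+-identityˡ _) ⟩
      0ℤ + coeff (q ⊗ E) k                    ≡⟨ cong (_+ coeff (q ⊗ E) k) (sym (trans (cong (a *_) (E-deg (suc k) (s≤s n≤k))) (ℤP.*-zeroʳ a))) ⟩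
      a * coeff E (suc k) + coeff (q ⊗ E) k   ≡⟨ sym (coeff-∷-⊗ a q E (suc k)) ⟩
      coeff ((a ∷ q) ⊗ E) (suc k)             ≡⟨ aqE<n (suc k) (ℕP.m≤n⇒m≤1+n n≤k) ⟩
      0ℤ                                      ∎
    q≈[] = multiple-below-n q qE<n
    a≡0 : a ≡ 0ℤ
    a≡0 = begin
      a                                        ≡⟨ sym (trans (cong (a *_) E-monic) (ℤP.*-identityʳ a)) ⟩
      a * coeff E n                            ≡⟨ sym (ℤP.+-identityʳ _) ⟩
      a * coeff E n + 0ℤ                       ≡⟨ cong (_+_ (a * coeff E n)) (sym (≈-at (≈-trans (shift-cong (⊗-cong q≈[] (≈-refl {E}))) shift-[]) n)) ⟩
      a * coeff E n + coeff (shift (q ⊗ E)) n  ≡⟨ sym (coeff-∷-⊗ a q E n) ⟩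
      coeff ((a ∷ q) ⊗ E) n                    ≡⟨ aqE<n n ℕP.≤-refl ⟩
      0ℤ                                       ∎

  reduced-≋[] : ∀ f → DegBelow n f → f ≋ [] → f ≈ []
  reduced-≋[] f f<n (q by f≈qE) = ≈-trans f≈qE (⊗-cong (multiple-below-n q qE<n) (≈-refl {E}))
    where
    qE<n : DegBelow n (q ⊗ E)
    qE<n k n≤k = trans (sym (≈-at f≈qE k)) (f<n k n≤k)

  no-proper-factor : ∀ {d} → 0 < d → d < n → ¬ FactorOfDegree d E
  no-proper-factor {d} 0<d d<n (h , u , E≈hu , ud≢0 , u≤d) with E-irreducible h u E≈hu
  ... | inj₂ u<1 = ud≢0 (u<1 d 0<d)
  ... | inj₁ h<1 = 1≢0 (begin
    1ℤ                   ≡⟨ sym E-monic ⟩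
    coeff E n            ≡⟨ ≈-at E≈hu n ⟩
    coeff (h ⊗ u) n      ≡⟨ ≈-at (⊗-cong (DegBelow-1⇒constant h h<1) (≈-refl {u})) n ⟩
    coeff ((coeff h 0 ∷ []) ⊗ u) n ≡⟨ ≈-at (constant-⊗ (coeff h 0) u) n ⟩
    coeff (coeff h 0 • u) n  ≡⟨ coeff-• (coeff h 0) u n ⟩
    coeff h 0 * coeff u n    ≡⟨ cong (coeff h 0 *_) (u≤d n d<n) ⟩
    coeff h 0 * 0ℤ           ≡⟨ ℤP.*-zeroʳ (coeff h 0) ⟩
    0ℤ                       ∎)
    where
    open ≡-Reasoning
    1≢0 : ¬ 1ℤ ≡ 0ℤ
    1≢0 ()

  module _ {P : List ℤ} (P-deg : DegBelow n P) (P≉[] : ¬ P ≈ []) where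

    no-constant-annihilator : ∀ u → HasDegree 0 u → ¬ u ⊗ P ≋ []
    no-constant-annihilator u (u0≢0 , u<1) uP≋[] = P≉[] (•-cancel u0 u0≢0 u0P≈[])
      where
      u0 = coeff u 0
      uP≈u0P : u ⊗ P ≈ u0 • P
      uP≈u0P = ≈-trans (⊗-cong (DegBelow-1⇒constant u u<1) (≈-refl {P})) (constant-⊗ u0 P)
      u0P≈[] : u0 • P ≈ []
      u0P≈[] = reduced-≋[] (u0 • P) (DegBelow-• u0 P P-deg) (≋-trans (≈⇒≋ (≈-sym uP≈u0P)) uP≋[])

    remainder-annihilates : ∀ {L h u r} → L • E ≈ h ⊗ u ⊕ r → u ⊗ P ≋ [] → r ⊗ P ≋ []
    remainder-annihilates {L} {h} {u} {r} LE≈hu+r uP≋[] = begin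
      r ⊗ P                                ≈⟨ ≈⇒≋ (⊗-cong r≈ (≈-refl {P})) ⟩
      (L • E ⊕ -1ℤ • (h ⊗ u)) ⊗ P          ≈⟨ ≈⇒≋ (⊗-distribʳ (L • E) (-1ℤ • (h ⊗ u)) P) ⟩
      (L • E) ⊗ P ⊕ (-1ℤ • (h ⊗ u)) ⊗ P    ≈⟨ ≈⇒≋ (⊕-cong (≈-trans (•-⊗ L E P) (•-cong L (⊗-comm E P)))
                                                         (≈-trans (•-⊗ -1ℤ (h ⊗ u) P) (•-cong -1ℤ (⊗-assoc h u P)))) ⟩
      L • (P ⊗ E) ⊕ -1ℤ • (h ⊗ (u ⊗ P))    ≈⟨ ⊕-cong-≋ (•-cong-≋ L (multiple≋[] P)) (•-cong-≋ -1ℤ (⊗-congʳ-≋ h uP≋[])) ⟩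
      L • [] ⊕ -1ℤ • (h ⊗ [])              ≈⟨ ≈⇒≋ (•-cong -1ℤ (⊗-zeroʳ h)) ⟩
      []                                   ∎
      where
      open import Relation.Binary.Reasoning.Setoid ≋-setoid
      r≈ : r ≈ L • E ⊕ -1ℤ • (h ⊗ u)
      r≈ = ≈-trans (⊕-cancelˡ (h ⊗ u) r) (⊕-cong (≈-sym LE≈hu+r) (≈-refl { -1ℤ • (h ⊗ u)}))

    no-annihilator : ∀ d → d < n → ∀ u → HasDegree d u → ¬ u ⊗ P ≋ []
    no-annihilator = <-rec _ step
      where
      step : ∀ d → (∀ {d′} → d′ < d → d′ < n → ∀ u → HasDegree d′ u → ¬ u ⊗ P ≋ []) →
             d < n → ∀ u → HasDegree d u → ¬ u ⊗ P ≋ []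
      step zero    _   _   u u-deg uP≋[] = no-constant-annihilator u u-deg uP≋[]
      step (suc d) rec d<n u u-deg uP≋[] = descend (zero⊎degree (suc d) r remainder-deg)
        where
        open PseudoDivision {u = u} u-deg
        open Result (divide (suc n) E E-deg) renaming (scale to L; quotient to h; remainder to r)
        descend : r ≈ [] ⊎ ∃ (λ d′ → d′ < suc d × HasDegree d′ r) → ⊥
        descend (inj₁ r≈[]) = no-proper-factor (s≤s z≤n) d<n (clear-scalar L scale≢0 (h , u , LE≈hu , u-deg))
          where
          LE≈hu : L • E ≈ h ⊗ u
          LE≈hu = ≈-trans division (≈-trans (⊕-cong (≈-refl {h ⊗ u}) r≈[]) (⊕-identityʳ (h ⊗ u)))
        descend (inj₂ (d′ , d′<d , r-deg)) =
          rec d′<d (ℕP.<-trans d′<d d<n) r r-deg (remainder-annihilates {L} {h} {u} {r} division uP≋[])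

    annihilator≈[] : ∀ c → DegBelow n c → c ⊗ P ≋ [] → c ≈ []
    annihilator≈[] c c<n cP≋[] with zero⊎degree n c c<n
    ... | inj₁ c≈[]              = c≈[]
    ... | inj₂ (d , d<n , c-deg) = ⊥-elim (no-annihilator d d<n c c-deg cP≋[])

-- Vectors of ℤⁿ as polynomials of degree < n

poly : ∀ {n} → Vec n → List ℤ
poly {zero}  v = []
poly {suc n} v = v Fin.zero ∷ poly (v ∘ Fin.suc)

coeff-poly : ∀ {n} (v : Vec n) j → coeff (poly v) (toℕ j) ≡ v j
coeff-poly v Fin.zero    = refl
coeff-poly v (Fin.suc j) = coeff-poly (v ∘ Fin.suc) j

length-poly : ∀ {n} (v : Vec n) → length (poly v) ≡ n
length-poly {zero}  v = refl
length-poly {suc n} v = cong suc (length-poly (v ∘ Fin.suc))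

coeff-length : ∀ f k → length f ≤ k → coeff f k ≡ 0ℤ
coeff-length []      k       _         = refl
coeff-length (a ∷ f) (suc k) (s≤s f≤k) = coeff-length f k f≤k

poly-deg : ∀ {n} (v : Vec n) → DegBelow n (poly v)
poly-deg {n} v k n≤k = coeff-length (poly v) k (subst (_≤ k) (sym (length-poly v)) n≤k)

poly-≈ : ∀ {n} (v : Vec n) f → (∀ j → v j ≡ coeff f (toℕ j)) → DegBelow n f → poly v ≈ f
poly-≈ {zero}  v f _   f<0 = coeffwise λ k → sym (f<0 k z≤n)
poly-≈ {suc n} v f v≡f f≤n = coeffwise λ
  { zero    → v≡f Fin.zero
  ; (suc k) → trans (≈-at tail≈ k) (coeff-drop1 f k) }
  where
  coeff-drop1 : ∀ f k → coeff (drop 1 f) k ≡ coeff f (suc k)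
  coeff-drop1 []      k = refl
  coeff-drop1 (_ ∷ f) k = refl
  tail≈ : poly (v ∘ Fin.suc) ≈ drop 1 f
  tail≈ = poly-≈ (v ∘ Fin.suc) (drop 1 f)
    (λ j → trans (v≡f (Fin.suc j)) (sym (coeff-drop1 f (toℕ j))))
    (λ k n≤k → trans (coeff-drop1 f k) (f≤n (suc k) (s≤s n≤k)))

poly-cong : ∀ {n} {v w : Vec n} → (∀ j → v j ≡ w j) → poly v ≈ poly w
poly-cong {n} {v} {w} v≡w = poly-≈ v (poly w) (λ j → trans (v≡w j) (sym (coeff-poly w j))) (poly-deg w)

poly≈[] : ∀ {n} (v : Vec n) → poly v ≈ [] → ∀ j → v j ≡ 0ℤ
poly≈[] v v≈[] j = trans (sym (coeff-poly v j)) (≈-at v≈[] (toℕ j))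

poly-zero : ∀ n → poly {n} (λ _ → 0ℤ) ≈ []
poly-zero zero    = ≈-refl
poly-zero (suc n) = coeffwise λ { zero → refl ; (suc k) → ≈-at (poly-zero n) k }

poly-+ : ∀ {n} (v w : Vec n) → poly (λ j → v j + w j) ≈ poly v ⊕ poly w
poly-+ {zero}  v w = ≈-refl
poly-+ {suc n} v w = coeffwise λ { zero → refl ; (suc k) → ≈-at (poly-+ (v ∘ Fin.suc) (w ∘ Fin.suc)) k }

poly-• : ∀ {n} z (v : Vec n) → poly (λ j → z * v j) ≈ z • poly v
poly-• {zero}  z v = ≈-refl
poly-• {suc n} z v = coeffwise λ { zero → refl ; (suc k) → ≈-at (poly-• z (v ∘ Fin.suc)) k }

lincomb : ∀ {m} → Vec m → (Fin m → List ℤ) → List ℤ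
lincomb {zero}  c f = []
lincomb {suc m} c f = c Fin.zero • f Fin.zero ⊕ lincomb (c ∘ Fin.suc) (f ∘ Fin.suc)

lincomb-cong : ∀ {m} (c : Vec m) {f g : Fin m → List ℤ} → (∀ i → f i ≈ g i) → lincomb c f ≈ lincomb c g
lincomb-cong {zero}  c f≈g = ≈-refl
lincomb-cong {suc m} c f≈g = ⊕-cong (•-cong (c Fin.zero) (f≈g Fin.zero)) (lincomb-cong (c ∘ Fin.suc) (f≈g ∘ Fin.suc))

lincomb-cong-≋ : ∀ {E} {m} (c : Vec m) {f g : Fin m → List ℤ} →
                 (∀ i → Modulo._≋_ E (f i) (g i)) → Modulo._≋_ E (lincomb c f) (lincomb c g)
lincomb-cong-≋ {E} {zero}  c f≋g = Modulo.≋-refl E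
lincomb-cong-≋ {E} {suc m} c f≋g = Modulo.⊕-cong-≋ E (Modulo.•-cong-≋ E (c Fin.zero) (f≋g Fin.zero))
  (lincomb-cong-≋ (c ∘ Fin.suc) (f≋g ∘ Fin.suc))

shiftBy-suc : ∀ j f → shiftBy (suc j) f ≡ shiftBy j (shift f)
shiftBy-suc zero    f = refl
shiftBy-suc (suc j) f = cong shift (shiftBy-suc j f)

lincomb-shiftBy : ∀ {m} (c : Vec m) g → lincomb c (λ i → shiftBy (toℕ i) g) ≈ poly c ⊗ g
lincomb-shiftBy {zero}  c g = ≈-refl
lincomb-shiftBy {suc m} c g = ⊕-cong (≈-refl {c Fin.zero • g}) (begin
  lincomb (c ∘ Fin.suc) (λ i → shiftBy (suc (toℕ i)) g)   ≈⟨ lincomb-cong (c ∘ Fin.suc) (λ i → ≈-reflexive (shiftBy-suc (toℕ i) g)) ⟩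
  lincomb (c ∘ Fin.suc) (λ i → shiftBy (toℕ i) (shift g)) ≈⟨ lincomb-shiftBy (c ∘ Fin.suc) (shift g) ⟩
  poly (c ∘ Fin.suc) ⊗ shift g                            ≈⟨ ⊗-shift (poly (c ∘ Fin.suc)) g ⟩
  shift (poly (c ∘ Fin.suc) ⊗ g)                          ∎)
  where open import Relation.Binary.Reasoning.Setoid ≈-setoid

poly-·ᵥ : ∀ {m n} (x : Vec m) (M : Mat m n) → poly (x ·ᵥ M) ≈ lincomb x (λ i → poly (M i))
poly-·ᵥ {zero}  x M = poly-zero _
poly-·ᵥ {suc m} x M = ≈-trans (poly-+ (λ j → x Fin.zero * M Fin.zero j) ((x ∘ Fin.suc) ·ᵥ (M ∘ Fin.suc)))
  (⊕-cong (poly-• (x Fin.zero) (M Fin.zero)) (poly-·ᵥ (x ∘ Fin.suc) (M ∘ Fin.suc)))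

Σ≡sum : ∀ n (f : Fin n → ℤ) → Σ[ n ] f ≡ sum f
Σ≡sum zero    f = refl
Σ≡sum (suc n) f = cong (_+_ (f Fin.zero)) (Σ≡sum n (f ∘ Fin.suc))

·ᵥ-zeroˡ : ∀ {m n} (x : Vec m) (M : Mat m n) → (∀ i → x i ≡ 0ℤ) → ∀ j → (x ·ᵥ M) j ≡ 0ℤ
·ᵥ-zeroˡ {m} x M x≡0 j = trans (Σ≡sum m _)
  (trans (sum-cong-≗ (λ i → trans (cong (_* M i j) (x≡0 i)) (ℤP.*-zeroˡ (M i j)))) (sum-replicate-zero m))

·ᵥ-·ₘ : ∀ {m k l} (x : Vec m) (M : Mat m k) (N : Mat k l) j → (x ·ᵥ (M ·ₘ N)) j ≡ ((x ·ᵥ M) ·ᵥ N) j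
·ᵥ-·ₘ {m} {k} x M N j = begin
  Σ[ m ] (λ i → x i * Σ[ k ] (λ t → M i t * N t j))
    ≡⟨ trans (Σ≡sum m _) (sum-cong-≗ λ i → trans (cong (x i *_) (Σ≡sum k _)) (*-distribˡ-sum (x i) (λ t → M i t * N t j))) ⟩
  sum (λ i → sum (λ t → x i * (M i t * N t j)))
    ≡⟨ ∑-comm (λ i t → x i * (M i t * N t j)) ⟩
  sum (λ t → sum (λ i → x i * (M i t * N t j)))
    ≡⟨ sum-cong-≗ (λ t → trans (sum-cong-≗ λ i → sym (ℤP.*-assoc (x i) (M i t) (N t j)))
                              (sym (*-distribʳ-sum (N t j) (λ i → x i * M i t)))) ⟩
  sum (λ t → sum (λ i → x i * M i t) * N t j)
    ≡⟨ sym (trans (Σ≡sum k _) (sum-cong-≗ λ t → cong (_* N t j) (Σ≡sum m _))) ⟩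
  Σ[ k ] (λ t → Σ[ m ] (λ i → x i * M i t) * N t j) ∎
  where open ≡-Reasoning

δ : ℕ → ℕ → ℤ
δ zero    zero    = 1ℤ
δ zero    (suc _) = 0ℤ
δ (suc _) zero    = 0ℤ
δ (suc i) (suc k) = δ i k

δ-refl : ∀ i → δ i i ≡ 1ℤ
δ-refl zero    = refl
δ-refl (suc i) = δ-refl i

δ-≢ : ∀ {i k} → ¬ i ≡ k → δ i k ≡ 0ℤ
δ-≢ {zero}  {zero}  i≢k = ⊥-elim (i≢k refl)
δ-≢ {zero}  {suc k} i≢k = refl
δ-≢ {suc i} {zero}  i≢k = refl
δ-≢ {suc i} {suc k} i≢k = δ-≢ (i≢k ∘ cong suc)

coeff-monomial : ∀ i k → coeff (monomial i) k ≡ δ i k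
coeff-monomial zero    zero    = refl
coeff-monomial zero    (suc k) = refl
coeff-monomial (suc i) zero    = refl
coeff-monomial (suc i) (suc k) = coeff-monomial i k

monomial-deg : ∀ i → DegBelow (suc i) (monomial i)
monomial-deg i k i<k = trans (coeff-monomial i k) (δ-≢ (ℕP.<⇒≢ i<k))

Id-δ : ∀ n (i j : Fin n) → Id n i j ≡ δ (toℕ i) (toℕ j)
Id-δ n i j with toℕ i ℕ.≟ toℕ j
... | yes i≡j = sym (trans (cong (λ t → δ t (toℕ j)) i≡j) (δ-refl (toℕ j)))
... | no  i≢j = sym (δ-≢ i≢j)

·ᵥ-Id : ∀ {n} (x : Vec n) j → (x ·ᵥ Id n) j ≡ x j
·ᵥ-Id {n} x j = trans (sym (coeff-poly (x ·ᵥ Id n) j)) (trans (≈-at x·Id≈x (toℕ j)) (coeff-poly x j))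
  where
  row : ∀ i → poly (Id n i) ≈ monomial (toℕ i)
  row i = poly-≈ (Id n i) (monomial (toℕ i)) (λ j → trans (Id-δ n i j) (sym (coeff-monomial (toℕ i) (toℕ j))))
            (DegBelow-mono (monomial (toℕ i)) (FinP.toℕ<n i) (monomial-deg (toℕ i)))
  x·Id≈x : poly (x ·ᵥ Id n) ≈ poly x
  x·Id≈x = begin
    poly (x ·ᵥ Id n)                   ≈⟨ poly-·ᵥ x (Id n) ⟩
    lincomb x (λ i → poly (Id n i))    ≈⟨ lincomb-cong x row ⟩
    lincomb x (λ i → monomial (toℕ i)) ≈⟨ lincomb-shiftBy x (1ℤ ∷ []) ⟩
    poly x ⊗ (1ℤ ∷ [])                 ≈⟨ ⊗-identityʳ (poly x) ⟩
    poly x                             ∎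
    where open import Relation.Binary.Reasoning.Setoid ≈-setoid

eval : ℤ → List ℤ → ℤ
eval x []      = 0ℤ
eval x (c ∷ f) = c + x * eval x f

eval-≈[] : ∀ x f → f ≈ [] → eval x f ≡ 0ℤ
eval-≈[] x []      _    = refl
eval-≈[] x (c ∷ f) f≈[] = trans (cong₂ _+_ (≈-at f≈[] 0)
  (trans (cong (x *_) (eval-≈[] x f (coeffwise (≈-at f≈[] ∘ suc)))) (ℤP.*-zeroʳ x))) refl

eval-cong : ∀ x {f g} → f ≈ g → eval x f ≡ eval x g
eval-cong x {[]}    {g}     f≈g = sym (eval-≈[] x g (≈-sym f≈g))
eval-cong x {c ∷ f} {[]}    f≈g = eval-≈[] x (c ∷ f) f≈g
eval-cong x {c ∷ f} {d ∷ g} f≈g =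
  cong₂ _+_ (≈-at f≈g 0) (cong (x *_) (eval-cong x {f} {g} (coeffwise (≈-at f≈g ∘ suc))))

eval-⊕ : ∀ x f g → eval x (f ⊕ g) ≡ eval x f + eval x g
eval-⊕ x []      g       = sym (ℤP.+-identityˡ _)
eval-⊕ x (c ∷ f) []      = sym (ℤP.+-identityʳ _)
eval-⊕ x (c ∷ f) (d ∷ g) = trans (cong (λ t → c + d + x * t) (eval-⊕ x f g))
  (regroup c d x (eval x f) (eval x g))
  where
  regroup : ∀ (c d x s t : ℤ) → c + d + x * (s + t) ≡ (c + x * s) + (d + x * t)
  regroup = solve-∀

eval-• : ∀ x z f → eval x (z • f) ≡ z * eval x f
eval-• x z []      = sym (ℤP.*-zeroʳ z)
eval-• x z (c ∷ f) = trans (cong (λ t → z * c + x * t) (eval-• x z f)) (regroup z c x (eval x f))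
  where
  regroup : ∀ (z c x s : ℤ) → z * c + x * (z * s) ≡ z * (c + x * s)
  regroup = solve-∀

eval-⊗ : ∀ x f g → eval x (f ⊗ g) ≡ eval x f * eval x g
eval-⊗ x []      g = sym (ℤP.*-zeroˡ (eval x g))
eval-⊗ x (a ∷ f) g = begin
  eval x (a • g ⊕ shift (f ⊗ g))              ≡⟨ eval-⊕ x (a • g) (shift (f ⊗ g)) ⟩
  eval x (a • g) + (0ℤ + x * eval x (f ⊗ g))   ≡⟨ cong₂ (λ s t → s + (0ℤ + x * t)) (eval-• x a g) (eval-⊗ x f g) ⟩
  a * eval x g + (0ℤ + x * (eval x f * eval x g)) ≡⟨ regroup a x (eval x f) (eval x g) ⟩
  (a + x * eval x f) * eval x g                ∎
  where
  open ≡-Reasoning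
  regroup : ∀ (a x s t : ℤ) → a * t + (0ℤ + x * (s * t)) ≡ (a + x * s) * t
  regroup = solve-∀

eval-monomial : ∀ x j → eval x (monomial j) ≡ x ℤ.^ j
eval-monomial x zero    = trans (cong (_+_ 1ℤ) (ℤP.*-zeroʳ x)) refl
eval-monomial x (suc j) = trans (ℤP.+-identityˡ _) (cong (x *_) (eval-monomial x j))

eval-poly : ∀ x {n} (v : Vec n) → eval x (poly v) ≡ Σ[ n ] (λ i → v i * x ℤ.^ toℕ i)
eval-poly x {zero}  v = refl
eval-poly x {suc n} v = begin
  v Fin.zero + x * eval x (poly (v ∘ Fin.suc))
    ≡⟨ cong₂ _+_ (sym (ℤP.*-identityʳ (v Fin.zero))) (cong (x *_) (trans (eval-poly x (v ∘ Fin.suc)) (Σ≡sum n _))) ⟩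
  v Fin.zero * 1ℤ + x * sum (λ i → v (Fin.suc i) * x ℤ.^ toℕ i)
    ≡⟨ cong (_+_ (v Fin.zero * 1ℤ)) (trans (*-distribˡ-sum x (λ i → v (Fin.suc i) * x ℤ.^ toℕ i))
         (sum-cong-≗ λ i → swap x (v (Fin.suc i)) (x ℤ.^ toℕ i))) ⟩
  v Fin.zero * 1ℤ + sum (λ i → v (Fin.suc i) * (x * x ℤ.^ toℕ i))
    ≡⟨ cong (_+_ (v Fin.zero * 1ℤ)) (sym (Σ≡sum n _)) ⟩
  Σ[ suc n ] (λ i → v i * x ℤ.^ toℕ i) ∎
  where
  open ≡-Reasoning
  swap : ∀ (x y z : ℤ) → x * (y * z) ≡ y * (x * z)
  swap = solve-∀

module _ (x : ℤ) {E : List ℤ} where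
  open Modulo E

  eval-≋ : ∀ {f g} (f≋g : f ≋ g) → eval x f ≡ eval x g + eval x (quotient f≋g) * eval x E
  eval-≋ {f} {g} (q by f≈) = trans (eval-cong x f≈) (trans (eval-⊕ x g (q ⊗ E)) (cong (_+_ (eval x g)) (eval-⊗ x q E)))

  ∣-eval-≋ : ∀ {d f g} → d ∣ eval x E → f ≋ g → d ∣ eval x g → d ∣ eval x f
  ∣-eval-≋ {d} d∣E f≋g d∣g = subst (d ∣_) (sym (eval-≋ f≋g)) (∣m∣n⇒∣m+n d∣g (∣n⇒∣m*n (eval x (quotient f≋g)) d∣E))

∣-eval-shiftBy : ∀ x {d} k {f} → d ∣ eval x f → d ∣ eval x (shiftBy k f)
∣-eval-shiftBy x zero    d∣f = d∣f
∣-eval-shiftBy x (suc k) d∣f = ∣m∣n⇒∣m+n (divides 0ℤ refl) (∣n⇒∣m*n x (∣-eval-shiftBy x k d∣f))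

synDiv : ℤ → List ℤ → List ℤ
synDiv x []      = []
synDiv x (c ∷ f) = eval x f ∷ synDiv x f

synDiv-spec : ∀ x f → f ≈ (eval x f ∷ []) ⊕ synDiv x f ⊗ (- x ∷ 1ℤ ∷ [])
synDiv-spec x []      = coeffwise λ { zero → refl ; (suc k) → refl }
synDiv-spec x (c ∷ f) = coeffwise λ
  { zero    → cancel c x (eval x f)
  ; (suc k) → trans (≈-at (synDiv-spec x f) k)
                    (≈-at (⊕-cong (≈-reflexive (cong (_∷ []) (sym (ℤP.*-identityʳ (eval x f)))))
                                  (≈-refl {synDiv x f ⊗ (- x ∷ 1ℤ ∷ [])})) k) }
  where
  cancel : ∀ (c x e : ℤ) → c ≡ c + x * e + (e * - x + 0ℤ)
  cancel = solve-∀

synDiv-deg : ∀ x f k → length f ≤ suc k → coeff (synDiv x f) k ≡ 0ℤ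
synDiv-deg x []          k       _         = refl
synDiv-deg x (c ∷ [])    zero    _         = refl
synDiv-deg x (c ∷ d ∷ f) zero    (s≤s ())
synDiv-deg x (c ∷ f)     (suc k) (s≤s f≤k) = synDiv-deg x f k f≤k

-- The polynomial E, the lattice 𝔏 and the companion matrix

coeff-shiftBy-linear : ∀ c i k → coeff (shiftBy i (c ∷ 1ℤ ∷ [])) k ≡ c * δ i k + δ (suc i) k
coeff-shiftBy-linear c zero    zero          = sym (trans (cong (_+ 0ℤ) (ℤP.*-identityʳ c)) (ℤP.+-identityʳ c))
coeff-shiftBy-linear c zero    (suc zero)    = sym (cong (_+ 1ℤ) (ℤP.*-zeroʳ c))
coeff-shiftBy-linear c zero    (suc (suc k)) = sym (cong (_+ 0ℤ) (ℤP.*-zeroʳ c))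
coeff-shiftBy-linear c (suc i) zero          = sym (cong (_+ 0ℤ) (ℤP.*-zeroʳ c))
coeff-shiftBy-linear c (suc i) (suc k)       = coeff-shiftBy-linear c i k

module Construction (n′ : ℕ) (a : Vec (suc n′)) (p γ : ℤ) where

  n : ℕ
  n = suc n′

  A : Mat n n
  A = matA n p γ

  C : Mat n n
  C = companion n a

  E : List ℤ
  E = poly a ⊕ monomial n

  open Modulo E

  E-monic : coeff E n ≡ 1ℤ
  E-monic = trans (coeff-⊕ (poly a) (monomial n) n)
    (trans (cong₂ _+_ (poly-deg a n ℕP.≤-refl) (trans (coeff-monomial n n) (δ-refl n))) refl)

  E-deg : DegBelow (suc n) E
  E-deg = DegBelow-⊕ (poly a) (monomial n) (DegBelow-mono (poly a) (ℕP.n≤1+n n) (poly-deg a)) (monomial-deg n)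

  coeff-E : ∀ k → coeff E k ≡ monicPoly n a k
  coeff-E k with k ℕ.<? n
  ... | yes k<n = trans (coeff-⊕ (poly a) (monomial n) k) (trans (cong₂ _+_
          (trans (cong (coeff (poly a)) (sym (FinP.toℕ-fromℕ< k<n))) (coeff-poly a (Fin.fromℕ< k<n)))
          (trans (coeff-monomial n k) (δ-≢ (ℕP.>⇒≢ k<n)))) (ℤP.+-identityʳ _))
  ... | no k≮n with k ℕ.≟ n
  ...   | yes refl = E-monic
  ...   | no  k≢n  = E-deg k (ℕP.≤∧≢⇒< (ℕP.≮⇒≥ k≮n) (k≢n ∘ sym))

  eval-E : eval γ E ≡ evalMonic n a γ
  eval-E = trans (eval-⊕ γ (poly a) (monomial n))
    (trans (cong₂ _+_ (eval-poly γ a) (eval-monomial γ n)) (ℤP.+-comm _ (γ ℤ.^ n)))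

  E-irreducible : Irreducible (monicPoly n a) → ∀ h u → E ≈ h ⊗ u → DegBelow 1 h ⊎ DegBelow 1 u
  E-irreducible (_ , _ , factors-trivially) h u E≈hu =
    Sum.map (constant h) (constant u)
      (factors-trivially (coeff h) (coeff u) (length h , coeff-length h) (length u , coeff-length u)
        (λ k → trans (sym (coeff-⊗ h u k)) (trans (sym (≈-at E≈hu k)) (coeff-E k))))
    where
    constant : ∀ f → IsUnit (coeff f) → DegBelow 1 f
    constant f (_ , f≡0) (suc k) _ = f≡0 k

  X^n≋ : monomial n ≋ -1ℤ • poly a
  X^n≋ = (1ℤ ∷ []) by (begin
    monomial n                            ≈⟨ ⊕-cancelˡ (poly a) (monomial n) ⟩
    E ⊕ -1ℤ • poly a                      ≈⟨ ⊕-comm E (-1ℤ • poly a) ⟩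
    -1ℤ • poly a ⊕ E                      ≈⟨ ⊕-cong (≈-refl { -1ℤ • poly a}) (≈-sym (⊗-identityˡ E)) ⟩
    -1ℤ • poly a ⊕ (1ℤ ∷ []) ⊗ E          ∎)
    where open import Relation.Binary.Reasoning.Setoid ≈-setoid

  companion-last : ∀ i j → suc (toℕ i) ≡ n → C i j ≡ -1ℤ * a j
  companion-last i j last with suc (toℕ i) ℕ.≟ n
  ... | yes _    = sym (ℤP.-1*i≡-i (a j))
  ... | no ¬last = ⊥-elim (¬last last)

  companion-shift : ∀ i j → ¬ suc (toℕ i) ≡ n → C i j ≡ δ (suc (toℕ i)) (toℕ j)
  companion-shift i j ¬last with suc (toℕ i) ℕ.≟ n
  ... | yes last = ⊥-elim (¬last last)
  ... | no _ with toℕ j ℕ.≟ suc (toℕ i)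
  ...   | yes j≡ = sym (trans (cong (δ (suc (toℕ i))) j≡) (δ-refl (suc (toℕ i))))
  ...   | no  j≢ = sym (δ-≢ (j≢ ∘ sym))

  poly-C : ∀ i → poly (C i) ≋ monomial (suc (toℕ i))
  poly-C i = by-cases (suc (toℕ i) ℕ.≟ n)
    where
    by-cases : Dec (suc (toℕ i) ≡ n) → poly (C i) ≋ monomial (suc (toℕ i))
    by-cases (yes last) = subst (λ k → poly (C i) ≋ monomial k) (sym last)
      (≋-trans (≈⇒≋ (≈-trans (poly-cong (λ j → companion-last i j last)) (poly-• -1ℤ a))) (≋-sym X^n≋))
    by-cases (no ¬last) = ≈⇒≋ (poly-≈ (C i) (monomial (suc (toℕ i)))
      (λ j → trans (companion-shift i j ¬last) (sym (coeff-monomial (suc (toℕ i)) (toℕ j))))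
      (DegBelow-mono (monomial (suc (toℕ i))) (ℕP.≤∧≢⇒< (FinP.toℕ<n i) ¬last) (monomial-deg (suc (toℕ i)))))

  poly-·C : ∀ v → poly (v ·ᵥ C) ≋ shift (poly v)
  poly-·C v = begin
    poly (v ·ᵥ C)                                        ≈⟨ ≈⇒≋ (poly-·ᵥ v C) ⟩
    lincomb v (λ i → poly (C i))                         ≈⟨ lincomb-cong-≋ v poly-C ⟩
    lincomb v (λ i → monomial (suc (toℕ i)))             ≈⟨ ≈⇒≋ (lincomb-cong v (λ i → ≈-reflexive (shiftBy-suc (toℕ i) (1ℤ ∷ [])))) ⟩
    lincomb v (λ i → shiftBy (toℕ i) (shift (1ℤ ∷ [])))  ≈⟨ ≈⇒≋ (lincomb-shiftBy v (shift (1ℤ ∷ []))) ⟩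
    poly v ⊗ shift (1ℤ ∷ [])                             ≈⟨ ≈⇒≋ (⊗-shift (poly v) (1ℤ ∷ [])) ⟩
    shift (poly v ⊗ (1ℤ ∷ []))                           ≈⟨ ≈⇒≋ (shift-cong (⊗-identityʳ (poly v))) ⟩
    shift (poly v)                                       ∎
    where open import Relation.Binary.Reasoning.Setoid ≋-setoid

  poly-·C^ : ∀ (w : Vec n) k → poly (w ·ᵥ (C ^ₘ k)) ≋ shiftBy k (poly w)
  poly-·C^ w zero    = ≈⇒≋ (poly-cong (·ᵥ-Id w))
  poly-·C^ w (suc k) = ≋-trans (≈⇒≋ (poly-cong (·ᵥ-·ₘ w (C ^ₘ k) C)))
    (≋-trans (poly-·C (w ·ᵥ (C ^ₘ k))) (shift-cong-≋ (poly-·C^ w k)))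

  matA-zero : ∀ j → A Fin.zero j ≡ coeff (p ∷ []) (toℕ j)
  matA-zero j with toℕ j
  ... | zero  = refl
  ... | suc _ = refl

  matA-suc : ∀ i j → A (Fin.suc i) j ≡ (- γ) * δ (toℕ i) (toℕ j) + δ (suc (toℕ i)) (toℕ j)
  matA-suc i j with toℕ j
  ... | j′ with j′ ℕ.≟ toℕ i
  ...   | yes refl = sym (trans (cong₂ _+_ (trans (cong ((- γ) *_) (δ-refl j′)) (ℤP.*-identityʳ (- γ)))
                                         (δ-≢ (ℕP.1+n≢n {j′}))) (ℤP.+-identityʳ _))
  ...   | no j≢i with j′ ℕ.≟ suc (toℕ i)
  ...     | yes refl = sym (trans (cong₂ _+_ (trans (cong ((- γ) *_) (δ-≢ (j≢i ∘ sym))) (ℤP.*-zeroʳ (- γ)))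
                                           (δ-refl j′)) (ℤP.+-identityˡ _))
  ...     | no j≢1+i = sym (trans (cong₂ _+_ (trans (cong ((- γ) *_) (δ-≢ (j≢i ∘ sym))) (ℤP.*-zeroʳ (- γ)))
                                           (δ-≢ (j≢1+i ∘ sym))) refl)

  X-γ : List ℤ
  X-γ = - γ ∷ 1ℤ ∷ []

  poly-·A : ∀ y → poly (y ·ᵥ A) ≈ (y Fin.zero * p ∷ []) ⊕ poly (y ∘ Fin.suc) ⊗ X-γ
  poly-·A y = ≈-trans (poly-·ᵥ y A) (⊕-cong (•-cong (y Fin.zero) row₀)
    (≈-trans (lincomb-cong (y ∘ Fin.suc) rowₛ) (lincomb-shiftBy (y ∘ Fin.suc) X-γ)))
    where
    row₀ : poly (A Fin.zero) ≈ p ∷ []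
    row₀ = poly-≈ (A Fin.zero) (p ∷ []) matA-zero (λ { (suc k) _ → refl })
    rowₛ : ∀ i → poly (A (Fin.suc i)) ≈ shiftBy (toℕ i) X-γ
    rowₛ i = poly-≈ (A (Fin.suc i)) (shiftBy (toℕ i) X-γ)
      (λ j → trans (matA-suc i j) (sym (coeff-shiftBy-linear (- γ) (toℕ i) (toℕ j))))
      (λ k n≤k → trans (coeff-shiftBy-linear (- γ) (toℕ i) k)
         (cong₂ _+_ (trans (cong ((- γ) *_) (δ-≢ (ℕP.<⇒≢ (ℕP.<-trans (ℕP.n<1+n (toℕ i)) (below n≤k)))))
                           (ℤP.*-zeroʳ (- γ)))
                    (δ-≢ (ℕP.<⇒≢ (below n≤k)))))
      where
      below : ∀ {k} → n ≤ k → suc (toℕ i) < k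
      below n≤k = ℕP.<-≤-trans (s≤s (FinP.toℕ<n i)) n≤k

  p∣eval-·A : ∀ y → p ∣ eval γ (poly (y ·ᵥ A))
  p∣eval-·A y = divides (y Fin.zero) (begin
    eval γ (poly (y ·ᵥ A))                                               ≡⟨ eval-cong γ (poly-·A y) ⟩
    eval γ ((y Fin.zero * p ∷ []) ⊕ poly (y ∘ Fin.suc) ⊗ X-γ)            ≡⟨ eval-⊕ γ (y Fin.zero * p ∷ []) (poly (y ∘ Fin.suc) ⊗ X-γ) ⟩
    (y Fin.zero * p + γ * 0ℤ) + eval γ (poly (y ∘ Fin.suc) ⊗ X-γ)        ≡⟨ cong (_+_ (y Fin.zero * p + γ * 0ℤ)) (eval-⊗ γ (poly (y ∘ Fin.suc)) X-γ) ⟩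
    (y Fin.zero * p + γ * 0ℤ) + eval γ (poly (y ∘ Fin.suc)) * eval γ X-γ ≡⟨ root (y Fin.zero) p γ (eval γ (poly (y ∘ Fin.suc))) ⟩
    y Fin.zero * p                                                       ∎)
    where
    open ≡-Reasoning
    root : ∀ (y p γ t : ℤ) → (y * p + γ * 0ℤ) + t * (- γ + γ * (1ℤ + γ * 0ℤ)) ≡ y * p
    root = solve-∀

  p∣eval⇒∈𝔏 : ∀ v → p ∣ eval γ (poly v) → InLattice A v
  p∣eval⇒∈𝔏 v (divides q vγ≡qp) = y , λ j → trans (sym (coeff-poly v j)) (trans (≈-at v≈yA (toℕ j)) (coeff-poly (y ·ᵥ A) j))
    where
    y : Vec n
    y Fin.zero    = q
    y (Fin.suc i) = coeff (synDiv γ (poly v)) (toℕ i)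
    quotient≈ : poly (y ∘ Fin.suc) ≈ synDiv γ (poly v)
    quotient≈ = poly-≈ (y ∘ Fin.suc) (synDiv γ (poly v)) (λ _ → refl)
      (λ k n′≤k → synDiv-deg γ (poly v) k (subst (_≤ suc k) (sym (length-poly v)) (s≤s n′≤k)))
    v≈yA : poly v ≈ poly (y ·ᵥ A)
    v≈yA = ≈-trans (synDiv-spec γ (poly v)) (≈-sym (≈-trans (poly-·A y)
      (⊕-cong (≈-reflexive (cong (_∷ []) (sym vγ≡qp))) (⊗-cong quotient≈ (≈-refl {X-γ})))))

corollary2 :
    (n : ℕ) → 2 ≤ n → (p : ℤ) → + 2 ℤ≤ p →
    (a : Vec n) → Irreducible (monicPoly n a) →
    (γ : ℤ) → p ∣ᵤ evalMonic n a γ →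
    (V : Fin n → Vec n) →
    Σ (Vec n) (λ x → ∀ i j → V i j ≡ (x ·ᵥ matD-block n a p γ i) j) →
    ¬ (∀ i j → V i j ≡ 0ℤ) →
    ((i₀ : Fin n) → toℕ i₀ ≡ 0 → InLattice (matA n p γ) (V i₀))
      × ((∀ i → InLattice (matA n p γ) (V i)) × LinIndep V)
-- The hypothesis 2 ≤ n only excludes n = 0.
corollary2 (suc n′) _ p _ a irreducible γ p∣E V (x , V≡xD) V≢0 = V₀∈𝔏 , V∈𝔏 , independent
  where
  open Construction n′ a p γ
  open Modulo E
  w = x ·ᵥ A
  V≡wC^ : ∀ i j → V i j ≡ (w ·ᵥ (C ^ₘ toℕ i)) j
  V≡wC^ i j = trans (V≡xD i j) (·ᵥ-·ₘ x A (C ^ₘ toℕ i) j)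
  V≋X^w : ∀ i → poly (V i) ≋ shiftBy (toℕ i) (poly w)
  V≋X^w i = ≋-trans (≈⇒≋ (poly-cong (V≡wC^ i))) (poly-·C^ w (toℕ i))
  V₀∈𝔏 : ∀ i₀ → toℕ i₀ ≡ 0 → InLattice A (V i₀)
  V₀∈𝔏 i₀ i₀≡0 = x , λ j → trans (V≡wC^ i₀ j) (trans (cong (λ k → (w ·ᵥ (C ^ₘ k)) j) i₀≡0) (·ᵥ-Id w j))
  V∈𝔏 : ∀ i → InLattice A (V i)
  V∈𝔏 i = p∣eval⇒∈𝔏 (V i) (∣-eval-≋ γ (subst (p ∣_) (sym eval-E) (∣ᵤ⇒∣ p∣E)) (V≋X^w i)
    (∣-eval-shiftBy γ (toℕ i) (p∣eval-·A x)))
  independent : LinIndep V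
  independent c cV≡0 = poly≈[] c (annihilator≈[] (poly-deg w) w≉[] (poly c) (poly-deg c) (begin
    poly c ⊗ poly w                             ≈⟨ ≈⇒≋ (≈-sym (lincomb-shiftBy c (poly w))) ⟩
    lincomb c (λ i → shiftBy (toℕ i) (poly w))  ≈⟨ ≋-sym (lincomb-cong-≋ c V≋X^w) ⟩
    lincomb c (λ i → poly (V i))                ≈⟨ ≈⇒≋ (≈-sym (poly-·ᵥ c V)) ⟩
    poly (c ·ᵥ V)                               ≈⟨ ≈⇒≋ (≈-trans (poly-cong cV≡0) (poly-zero (suc n′))) ⟩
    []                                          ∎))
    where
    open import Relation.Binary.Reasoning.Setoid ≋-setoid
    open NoZeroDivisors E-monic E-deg (E-irreducible irreducible)
    w≉[] : ¬ poly w ≈ []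
    w≉[] w≈[] = V≢0 λ i j → trans (V≡wC^ i j) (·ᵥ-zeroˡ w (C ^ₘ toℕ i) (poly≈[] w w≈[]) j)
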